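{- Let $P$ be a finite poset and $A$ a sub-digraph of $P$. If $(x',y')$ is an arc of $P$ that is useless in $A$, then $G(P,A\cup\{(x',y')\})=G(P,A\setminus\{(x',y')\})$; that is, the graph $G(P,A)$ is unchanged by adding or removing useless arcs. Consequently there is a sub-digraph $A'$ of $P$ satisfying: whenever $u'\le u\le v\le v'$ in $P$ and $(u',v')\in A'$ then $(u,v)\in A'$, and such that $G(P,A')=G(P,A)$.
   Context: A poset $P$ is viewed as a reflexive digraph with an arc $(a,b)$ whenever $a\le b$ (including loops). A sub-digraph $A$ of $P$ has the same vertex set and a subset of the arcs. $\mathcal{D}(P)$ is the set of downsets of $P$. The graph $G(P,A)$ has vertex set $\mathcal{D}(P)$, with $D\sim D'$ iff $A$ contains every arc $(x,y)$ of $P$ for which $x,y$ both lie in $D\setminus D'$ or both lie in $D'\setminus D$. An arc $(x',y')$ of $P$ is useless in $A$ if there is an arc $(x,y)$ of $P$ not in $A$ with $x'\le x\le y\le y'$ and $(x,y)\neq(x',y')$. -}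

module Defs where

open import Level using (0ℓ)
open import Data.Nat using (ℕ)
open import Data.Fin using (Fin)
open import Data.Fin.Subset using (Subset; _∈_; _∉_)
open import Data.Product using (Σ; ∃; _×_; _,_)
open import Data.Sum using (_⊎_)
open import Relation.Nullary using (¬_)
open import Relation.Binary using (Rel; IsPartialOrder)
open import Relation.Binary.PropositionalEquality using (_≡_)
open import Function.Bundles using (_⇔_)

Digraph : ℕ → Set₁
Digraph n = Rel (Fin n) 0ℓ

module _ {n : ℕ} (_≤_ : Rel (Fin n) 0ℓ) where

  IsSubDigraph : Digraph n → Set
  IsSubDigraph A = ∀ x y → A x y → x ≤ y

  IsDownset : Subset n → Set
  IsDownset D = ∀ x y → x ≤ y → y ∈ D → x ∈ D

  ArcsInside : Digraph n → Subset n → Subset n → Set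
  ArcsInside A D D' = ∀ x y → x ≤ y → x ∈ D → x ∉ D' → y ∈ D → y ∉ D' → A x y

  -- Adjacency of G(P,A) on downsets.
  Adj : Digraph n → Subset n → Subset n → Set
  Adj A D D' = ArcsInside A D D' × ArcsInside A D' D

  -- G(P,A) = G(P,B): same vertex set D(P) (automatic) and same adjacency.
  SameG : Digraph n → Digraph n → Set
  SameG A B = ∀ D D' → IsDownset D → IsDownset D' → (Adj A D D' ⇔ Adj B D D')

  Useless : Digraph n → Fin n → Fin n → Set
  Useless A x' y' = Σ (Fin n) λ x → Σ (Fin n) λ y →
    x' ≤ x × x ≤ y × y ≤ y' × ¬ A x y × ¬ (x ≡ x' × y ≡ y')

  InwardClosed : Digraph n → Set
  InwardClosed A = ∀ u' u v v' → u' ≤ u → u ≤ v → v ≤ v' → A u' v' → A u v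

addArc : ∀ {n} → Digraph n → Fin n → Fin n → Digraph n
addArc A x' y' x y = A x y ⊎ (x ≡ x' × y ≡ y')

removeArc : ∀ {n} → Digraph n → Fin n → Fin n → Digraph n
removeArc A x' y' x y = A x y × ¬ (x ≡ x' × y ≡ y')

-- Since downsets are closed downwards, D ∖ D' is convex: if x ≤ w ≤ y with x, y ∈ D ∖ D',
-- then w ∈ D ∖ D'. Hence whenever G(P,A) joins D and D', every arc (u,v) nested inside an
-- arc (x,y) within D ∖ D' (or D' ∖ D) also lies there and so belongs to A. In other words A
-- and its inner part, the arcs (x,y) all of whose nested arcs lie in A, define the same graph,
-- and so does any B between them. The inner part is inward closed by construction, and adding
-- a useless arc (x',y') to A cannot put it into the inner part, because of the arc (x,y) ∉ A
-- nested inside it; so A ∪ {(x',y')} and A ∖ {(x',y')} lie between the same pair.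
module Submission where

open import Defs
open import Level using (0ℓ)
open import Data.Nat using (ℕ)
open import Data.Fin using (Fin)
open import Data.Fin.Subset using (_∈_; _∉_)
open import Data.Product using (Σ; _×_; _,_; proj₁; proj₂)
open import Data.Sum using (inj₁; inj₂)
open import Data.Empty using (⊥-elim)
open import Relation.Nullary using (¬_)
open import Relation.Binary using (Rel; IsPartialOrder; Reflexive; Transitive; _⇒_)
open import Relation.Binary.PropositionalEquality using (_≡_; refl)
open import Function.Bundles using (mk⇔)
import Function.Properties.Equivalence as ⇔

removeArc⇒addArc : ∀ {n} (A : Digraph n) x' y' → removeArc A x' y' ⇒ addArc A x' y'
removeArc⇒addArc A x' y' (Axy , _) = inj₁ Axy

module _ {n : ℕ} (_≤_ : Rel (Fin n) 0ℓ) where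

  Inner : Digraph n → Digraph n
  Inner A x y = x ≤ y × (∀ u v → x ≤ u → u ≤ v → v ≤ y → A u v)

  ArcsInside-mono : ∀ {A B} → A ⇒ B → ∀ {D D'} →
    ArcsInside _≤_ A D D' → ArcsInside _≤_ B D D'
  ArcsInside-mono A⇒B inside x y x≤y x∈D x∉D' y∈D y∉D' = A⇒B (inside x y x≤y x∈D x∉D' y∈D y∉D')

  Adj-mono : ∀ {A B} → A ⇒ B → ∀ {D D'} → Adj _≤_ A D D' → Adj _≤_ B D D'
  Adj-mono A⇒B (inside , inside') = ArcsInside-mono A⇒B inside , ArcsInside-mono A⇒B inside'

  SameG-sym : ∀ {A B} → SameG _≤_ A B → SameG _≤_ B A
  SameG-sym same D D' dD dD' = ⇔.sym (same D D' dD dD')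

  Inner⇒ : Reflexive _≤_ → ∀ {A} → Inner A ⇒ A
  Inner⇒ ≤-refl {x = x} {y} (x≤y , nested) = nested x y ≤-refl x≤y ≤-refl

  module _ (≤-trans : Transitive _≤_) where

    Inner-inwardClosed : ∀ A → InwardClosed _≤_ (Inner A)
    Inner-inwardClosed A u' u v v' u'≤u u≤v v≤v' (_ , nested) =
      u≤v , λ a b u≤a a≤b b≤v → nested a b (≤-trans u'≤u u≤a) a≤b (≤-trans b≤v v≤v')

    difference-convex : ∀ {D D'} → IsDownset _≤_ D → IsDownset _≤_ D' →
      ∀ {x w y} → x ≤ w → w ≤ y → x ∉ D' → y ∈ D → w ∈ D × w ∉ D'
    difference-convex dD dD' {x} {w} {y} x≤w w≤y x∉D' y∈D =
      dD w y w≤y y∈D , λ w∈D' → x∉D' (dD' x w x≤w w∈D')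

    ArcsInside-Inner : ∀ {A D D'} → IsDownset _≤_ D → IsDownset _≤_ D' →
      ArcsInside _≤_ A D D' → ArcsInside _≤_ (Inner A) D D'
    ArcsInside-Inner {A} dD dD' inside x y x≤y x∈D x∉D' y∈D y∉D' = x≤y , nestedInA
      where
      nestedInA : ∀ u v → x ≤ u → u ≤ v → v ≤ y → A u v
      nestedInA u v x≤u u≤v v≤y =
        let u∈D , u∉D' = difference-convex dD dD' x≤u (≤-trans u≤v v≤y) x∉D' y∈D
            v∈D , v∉D' = difference-convex dD dD' (≤-trans x≤u u≤v) v≤y x∉D' y∈D
        in inside u v u≤v u∈D u∉D' v∈D v∉D'

    SameG-between : ∀ {A B} → Inner A ⇒ B → B ⇒ A → SameG _≤_ A B
    SameG-between Inner⇒B B⇒A D D' dD dD' = mk⇔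
      (λ (inside , inside') → ArcsInside-mono Inner⇒B (ArcsInside-Inner dD dD' inside)
                            , ArcsInside-mono Inner⇒B (ArcsInside-Inner dD' dD inside'))
      (Adj-mono B⇒A)

  Inner-addArc-useless : Reflexive _≤_ → ∀ A x' y' → Useless _≤_ A x' y' →
    Inner (addArc A x' y') ⇒ removeArc A x' y'
  Inner-addArc-useless ≤-refl A x' y' (x , y , x'≤x , x≤y , y≤y' , ¬Axy , ≢x'y') {a} {b} inner =
    Aab , ab≢x'y'
    where
    notAdded : ¬ addArc A x' y' x y
    notAdded (inj₁ Axy) = ¬Axy Axy
    notAdded (inj₂ xy≡x'y') = ≢x'y' xy≡x'y'

    ab≢x'y' : ¬ (a ≡ x' × b ≡ y')
    ab≢x'y' (refl , refl) = notAdded (proj₂ inner x y x'≤x x≤y y≤y')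

    Aab : A a b
    Aab with Inner⇒ ≤-refl inner
    ... | inj₁ Aab = Aab
    ... | inj₂ ab≡x'y' = ⊥-elim (ab≢x'y' ab≡x'y')

lemma4p1 : (n : ℕ) (_≤_ : Rel (Fin n) 0ℓ) → IsPartialOrder _≡_ _≤_ →
    (A : Digraph n) → IsSubDigraph _≤_ A →
    ((x' y' : Fin n) → x' ≤ y' → Useless _≤_ A x' y' →
      SameG _≤_ (addArc A x' y') (removeArc A x' y'))
    × Σ (Digraph n) (λ A' → IsSubDigraph _≤_ A' × InwardClosed _≤_ A' × SameG _≤_ A' A)
lemma4p1 n _≤_ po A _ =
  (λ x' y' _ useless → SameG-between _≤_ ≤-trans
      (Inner-addArc-useless _≤_ ≤-refl A x' y' useless) (removeArc⇒addArc A x' y'))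
  , Inner _≤_ A
  , (λ _ _ → proj₁)
  , Inner-inwardClosed _≤_ ≤-trans A
  , SameG-sym _≤_ (SameG-between _≤_ ≤-trans (λ inner → inner) (Inner⇒ _≤_ ≤-refl))
  where open IsPartialOrder po renaming (refl to ≤-refl; trans to ≤-trans)
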